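{- Let $E$ be a finite nonempty set, $f:2^E\to\mathbb{N}$ an integral polymatroid rank function, $\mathbf{t}\in\mathbb{N}^E$, and $C_e:\mathbb{N}\times\mathbb{N}\to\mathbb{R}_+$ regular for each $e\in E$. Let $D\subset\mathbb{N}$ be a set of integers with $\mathbb{B}_f(d)\neq\emptyset$ for all $d\in D$, and for $d\in D$ let $P(\mathbf{t},d)$ denote the problem of minimizing $\sum_{e\in E}C_e(x_e;t_e)$ over $\mathbf{x}\in\mathbb{B}_f(d)$. Then for every $d,d'\in D$ with $|d-d'|=1$ and every optimal solution $\mathbf{x}^*(\mathbf{t},d)$ of $P(\mathbf{t},d)$ there is an optimal solution $\mathbf{x}^*(\mathbf{t},d')$ of $P(\mathbf{t},d')$ with $\|\mathbf{x}^*(\mathbf{t},d)-\mathbf{x}^*(\mathbf{t},d')\|_1\le |d-d'|=1$.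
   Context: An integral polymatroid rank function is a submodular, monotone, normalized ($f(\emptyset)=0$) set function $f:2^E\to\mathbb{N}$. $x(U)=\sum_{e\in U}x_e$; $\mathbb{B}_f(d)=\{\mathbf{x}\in\mathbb{N}^E: x(U)\le f(U)\ \forall U\subseteq E,\ x(E)=d\}$. $\|\cdot\|_1$ is the $L_1$-norm. For $C:\mathbb{N}\times\mathbb{N}\to\mathbb{R}$, $C^-(x;t)=C(x;t)-C(x-1;t)$ for $x\ge1$. $C$ is regular if $C^-(x;t)\le C^-(x;t+1)$ and $C^-(x;t+1)\le C^-(x+1;t)$ for all $x,t\in\mathbb{N}$ (where defined). -}

module Defs where

open import Level using (Level; _⊔_) renaming (suc to lsuc)
open import Data.Nat as ℕ using (ℕ; zero; suc; _+_; ∣_-_∣)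
open import Data.Fin using (Fin; zero; suc)
open import Data.Bool using (if_then_else_)
open import Data.Vec using (lookup)
open import Data.Fin.Subset using (Subset; ⊥; ⊤; _⊆_; _∪_; _∩_)
open import Data.Product using (Σ; _×_; ∃)
open import Relation.Binary.Core using (Rel)
open import Relation.Binary.PropositionalEquality using (_≡_)
open import Relation.Binary.Structures using (IsTotalOrder)
open import Algebra.Bundles using (AbelianGroup)

-- The paper uses costs in ℝ₊; agda-stdlib has no reals, so
-- costs take values in an arbitrary totally ordered abelian group
-- (ℝ is an instance).

record OrderedAbelianGroup (c ℓ₁ ℓ₂ : Level) : Set (lsuc (c ⊔ ℓ₁ ⊔ ℓ₂)) where
  field
    abelianGroup : AbelianGroup c ℓ₁
  open AbelianGroup abelianGroup public
  field
    _≤_          : Rel Carrier ℓ₂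
    isTotalOrder : IsTotalOrder _≈_ _≤_
    +-monoˡ-≤    : ∀ {x y} z → x ≤ y → (x ∙ z) ≤ (y ∙ z)

sumFin : ∀ {a} {A : Set a} → (A → A → A) → A → (n : ℕ) → (Fin n → A) → A
sumFin _⊕_ z zero    g = z
sumFin _⊕_ z (suc n) g = g zero ⊕ sumFin _⊕_ z n (λ i → g (suc i))

Σℕ : (n : ℕ) → (Fin n → ℕ) → ℕ
Σℕ = sumFin _+_ 0

x[_] : ∀ {n} → (Fin n → ℕ) → Subset n → ℕ
x[_] {n} x U = Σℕ n (λ e → if lookup U e then x e else 0)

record IsPolymatroid {n : ℕ} (f : Subset n → ℕ) : Set where
  field
    normalized : f ⊥ ≡ 0
    monotone   : ∀ A B → A ⊆ B → f A ℕ.≤ f B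
    submodular : ∀ A B → f (A ∪ B) + f (A ∩ B) ℕ.≤ f A + f B

_∈B[_,_] : ∀ {n} → (Fin n → ℕ) → (Subset n → ℕ) → ℕ → Set
_∈B[_,_] {n} x f d = (∀ U → x[ x ] U ℕ.≤ f U) × (x[ x ] ⊤ ≡ d)

dist₁ : ∀ {n} → (Fin n → ℕ) → (Fin n → ℕ) → ℕ
dist₁ {n} x y = Σℕ n (λ e → ∣ x e - y e ∣)

module _ {c ℓ₁ ℓ₂} (G : OrderedAbelianGroup c ℓ₁ ℓ₂) where
  open OrderedAbelianGroup G

  -- C⁻(x;t) = C(x;t) - C(x-1;t), for x ≥ 1; here x = suc k
  C⁻ : (ℕ → ℕ → Carrier) → ℕ → ℕ → Carrier
  C⁻ C k t = C (suc k) t - C k t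

  record IsRegular (C : ℕ → ℕ → Carrier) : Set ℓ₂ where
    field
      reg₁ : ∀ k t → C⁻ C k t ≤ C⁻ C k (suc t)
      reg₂ : ∀ k t → C⁻ C k (suc t) ≤ C⁻ C (suc k) t

  totalCost : ∀ {n} → (Fin n → ℕ → ℕ → Carrier) → (Fin n → ℕ) → (Fin n → ℕ) → Carrier
  totalCost {n} C t x = sumFin _∙_ ε n (λ e → C e (x e) (t e))

  IsOptimal : ∀ {n} → (Subset n → ℕ) → (Fin n → ℕ → ℕ → Carrier) → (Fin n → ℕ) → ℕ → (Fin n → ℕ) → Set (ℓ₂)
  IsOptimal f C t d x = x ∈B[ f , d ] × (∀ y → y ∈B[ f , d ] → totalCost C t x ≤ totalCost C t y)

module Submission where

-- Let x be optimal for P(t,d) and y any optimal solution for P(t,d′), d′ = d ± 1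
-- (one exists since B_f(d′) is finite and nonempty).  While ‖x - y‖₁ > 1 we replace y by
-- an optimal y′ strictly closer to x, so well-founded descent on the distance ends with an
-- optimal solution within distance 1 of x.  One descent step combines two facts:
--   * the exchange property of polymatroids: if p, q ∈ P(f), p(E) ≤ q(E) and q_g < p_g,
--     there is h with p_h < q_h such that p - χ_g + χ_h and q - χ_h + χ_g lie in P(f)
--     (h is found in R ∖ S, where S is the largest p-tight set avoiding g and R the
--     smallest set containing g that is q-tight or all of E);
--   * convexity of each C_e(·; t_e), which follows from regularity: optimality of x bounds
--     the marginal costs at g and h, and the same bound then makes the move of y to
--     y - χ_h + χ_g no more expensive.

open import Defs
open import Algebra.Bundles using (CommutativeMonoid)
open import Data.Bool using (true; false; if_then_else_; _∧_; _∨_; not)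
open import Data.Bool.Properties using () renaming (_≟_ to _≟ᵇ_)
open import Data.Fin using (Fin; zero; suc)
open import Data.Fin.Properties using (any?) renaming (_≟_ to _≟ᶠ_)
open import Data.Fin.Subset using (Subset; ⊥; ⊤; _∪_; _∩_; ∁; ⋃; ⋂; _∈_; _∉_; _⊆_)
open import Data.Fin.Subset.Properties
  using (_∈?_; p⊆p∪q; q⊆p∪q; p∩q⊆p; p∩q⊆q; ∪-zeroˡ; ∩-identityˡ; ∩-identityʳ;
         x∉p⇒x∈∁p; x∈p⇒x∉∁p; x∈p∩q⁺; x∈p∪q⁻; ∉⊥; ∈⊤)
open import Data.List using (List; []; _∷_; filter; cartesianProductWith; upTo)
open import Data.List.Membership.Propositional using () renaming (_∈_ to _∈ˡ_)
open import Data.List.Membership.Propositional.Properties using (∈-filter⁺; ∈-cartesianProductWith⁺; ∈-upTo⁺)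
open import Data.List.Relation.Unary.All as All using (All; []; _∷_)
open import Data.List.Relation.Unary.All.Properties using (all-filter)
open import Data.List.Relation.Unary.Any using (here; there)
open import Data.Nat
  using (ℕ; zero; suc; pred; _+_; _*_; _∸_; _≤_; _<_; _≤′_; ≤′-reflexive; ≤′-step; z≤n; s≤s; ∣_-_∣; >-nonZero)
open import Data.Nat.Induction using (<-wellFounded)
open import Data.Nat.Properties
open import Algebra.Properties.CommutativeSemigroup +-commutativeSemigroup
  using (x∙yz≈y∙xz; xy∙z≈xz∙y; xy∙z≈zx∙y)
open import Data.Product using (_×_; _,_; ∃; ∃₂; proj₁; proj₂)
open import Data.Sum using (_⊎_; inj₁; inj₂; [_,_])
open import Data.Vec using ([]; _∷_; lookup)
open import Data.Vec.Properties using (lookup-zipWith; lookup-replicate; lookup-map; []=⇒lookup; lookup⇒[]=; ≡-dec)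
import Data.Vec.Functional as Vector
open import Data.Vec.Functional using (updateAt)
open import Data.Vec.Functional.Properties using (updateAt-updates; updateAt-minimal)
open import Function using (_∘_)
open import Induction.WellFounded using (Acc; acc)
open import Relation.Binary.Bundles using (Poset; TotalOrder)
open import Relation.Binary.Structures using (IsTotalOrder)
open import Relation.Binary.PropositionalEquality
  using (_≡_; _≢_; refl; sym; trans; cong; cong₂; subst; subst₂; module ≡-Reasoning)
open import Relation.Nullary using (yes; no; contradiction; ¬?)
open import Relation.Nullary.Decidable using (_×-dec_; _⊎-dec_)
open import Relation.Unary using (Decidable)

module FinSum {c ℓ} (M : CommutativeMonoid c ℓ) where
  open CommutativeMonoid M renaming (refl to ≈-refl; sym to ≈-sym; trans to ≈-trans) hiding (setoid)
  open import Relation.Binary.Reasoning.Setoid (CommutativeMonoid.setoid M)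
  open import Algebra.Solver.CommutativeMonoid M using (solve; _⊕_; _⊜_)

  ∑ : (n : ℕ) → (Fin n → Carrier) → Carrier
  ∑ = sumFin _∙_ ε

  ∑-cong : ∀ n {F H : Fin n → Carrier} → (∀ e → F e ≈ H e) → ∑ n F ≈ ∑ n H
  ∑-cong zero    F≈H = ≈-refl
  ∑-cong (suc n) F≈H = ∙-cong (F≈H zero) (∑-cong n (λ e → F≈H (suc e)))

  ∑-distrib : ∀ n (F H : Fin n → Carrier) → ∑ n (λ e → F e ∙ H e) ≈ ∑ n F ∙ ∑ n H
  ∑-distrib zero    F H = ≈-sym (identityˡ ε)
  ∑-distrib (suc n) F H = begin
    (F zero ∙ H zero) ∙ ∑ n (λ e → F (suc e) ∙ H (suc e))
      ≈⟨ ∙-congˡ (∑-distrib n (λ e → F (suc e)) (λ e → H (suc e))) ⟩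
    (F zero ∙ H zero) ∙ (∑ n (λ e → F (suc e)) ∙ ∑ n (λ e → H (suc e)))
      ≈⟨ solve 4 (λ a b c d → (a ⊕ b) ⊕ (c ⊕ d) ⊜ (a ⊕ c) ⊕ (b ⊕ d)) ≈-refl _ _ _ _ ⟩
    (F zero ∙ ∑ n (λ e → F (suc e))) ∙ (H zero ∙ ∑ n (λ e → H (suc e))) ∎

  ∑-exchange₁ : ∀ n {F H : Fin n → Carrier} (i : Fin n) → (∀ e → e ≢ i → F e ≈ H e) →
                ∑ n F ∙ H i ≈ ∑ n H ∙ F i
  ∑-exchange₁ (suc n) {F} {H} zero F≈H = begin
    (F zero ∙ ∑ n (λ e → F (suc e))) ∙ H zero
      ≈⟨ ∙-congʳ (∙-congˡ (∑-cong n (λ e → F≈H (suc e) (λ ())))) ⟩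
    (F zero ∙ ∑ n (λ e → H (suc e))) ∙ H zero
      ≈⟨ solve 3 (λ a b c → (a ⊕ b) ⊕ c ⊜ (c ⊕ b) ⊕ a) ≈-refl _ _ _ ⟩
    (H zero ∙ ∑ n (λ e → H (suc e))) ∙ F zero ∎
  ∑-exchange₁ (suc n) {F} {H} (suc i) F≈H = begin
    (F zero ∙ ∑ n (λ e → F (suc e))) ∙ H (suc i)   ≈⟨ assoc _ _ _ ⟩
    F zero ∙ (∑ n (λ e → F (suc e)) ∙ H (suc i))
      ≈⟨ ∙-cong (F≈H zero (λ ())) (∑-exchange₁ n i (λ e e≢i → F≈H (suc e) (e≢i ∘ Data.Fin.Properties.suc-injective))) ⟩
    H zero ∙ (∑ n (λ e → H (suc e)) ∙ F (suc i))   ≈⟨ ≈-sym (assoc _ _ _) ⟩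
    (H zero ∙ ∑ n (λ e → H (suc e))) ∙ F (suc i)   ∎

  ∑-exchange₂ : ∀ n {F H : Fin n → Carrier} (g h : Fin n) → g ≢ h →
                (∀ e → e ≢ g → e ≢ h → F e ≈ H e) →
                ∑ n F ∙ (H g ∙ H h) ≈ ∑ n H ∙ (F g ∙ F h)
  ∑-exchange₂ n {F} {H} g h g≢h F≈H = begin
    ∑ n F ∙ (H g ∙ H h)  ≈⟨ ≈-sym (assoc _ _ _) ⟩
    (∑ n F ∙ H g) ∙ H h  ≈⟨ ∙-congʳ (∙-congˡ (reflexive (sym (updateAt-updates g F)))) ⟩
    (∑ n F ∙ G g) ∙ H h  ≈⟨ ∙-congʳ (∑-exchange₁ n g F≈G) ⟩
    (∑ n G ∙ F g) ∙ H h  ≈⟨ solve 3 (λ a b c → (a ⊕ b) ⊕ c ⊜ (a ⊕ c) ⊕ b) ≈-refl _ _ _ ⟩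
    (∑ n G ∙ H h) ∙ F g  ≈⟨ ∙-congʳ (∑-exchange₁ n h G≈H) ⟩
    (∑ n H ∙ G h) ∙ F g  ≈⟨ ∙-congʳ (∙-congˡ (reflexive (updateAt-minimal h g F (g≢h ∘ sym)))) ⟩
    (∑ n H ∙ F h) ∙ F g  ≈⟨ solve 3 (λ a b c → (a ⊕ b) ⊕ c ⊜ a ⊕ (c ⊕ b)) ≈-refl _ _ _ ⟩
    ∑ n H ∙ (F g ∙ F h)  ∎
    where
    G : Fin n → Carrier
    G = updateAt F g (λ _ → H g)
    F≈G : ∀ e → e ≢ g → F e ≈ G e
    F≈G e e≢g = reflexive (sym (updateAt-minimal e g F e≢g))
    G≈H : ∀ e → e ≢ h → G e ≈ H e
    G≈H e e≢h with e ≟ᶠ g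
    ... | yes refl = reflexive (updateAt-updates g F)
    ... | no e≢g   = ≈-trans (≈-sym (F≈G e e≢g)) (F≈H e e≢g e≢h)

open FinSum +-0-commutativeMonoid using () renaming (∑-cong to Σℕ-cong; ∑-distrib to Σℕ-distrib)

Σℕ-mono : ∀ n {F H : Fin n → ℕ} → (∀ e → F e ≤ H e) → Σℕ n F ≤ Σℕ n H
Σℕ-mono zero    F≤H = z≤n
Σℕ-mono (suc n) F≤H = +-mono-≤ (F≤H zero) (Σℕ-mono n (λ e → F≤H (suc e)))

Σℕ-strict : ∀ n {F H : Fin n → ℕ} → (∀ e → F e ≤ H e) → (i : Fin n) → F i < H i → Σℕ n F < Σℕ n H
Σℕ-strict (suc n) F≤H zero    Fi<Hi = +-mono-<-≤ Fi<Hi (Σℕ-mono n (λ e → F≤H (suc e)))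
Σℕ-strict (suc n) F≤H (suc i) Fi<Hi = +-mono-≤-< (F≤H zero) (Σℕ-strict n (λ e → F≤H (suc e)) i Fi<Hi)

entry≤Σ : ∀ n (v : Fin n → ℕ) e → v e ≤ Σℕ n v
entry≤Σ (suc n) v zero    = m≤m+n (v zero) _
entry≤Σ (suc n) v (suc e) = ≤-trans (entry≤Σ n (λ i → v (suc i)) e) (m≤n+m _ (v zero))

ind : ∀ {n} → Subset n → Fin n → ℕ
ind U e = if lookup U e then 1 else 0

ind-∈ : ∀ {n} {U : Subset n} {e} → e ∈ U → ind U e ≡ 1
ind-∈ e∈U rewrite []=⇒lookup e∈U = refl

ind-∉ : ∀ {n} {U : Subset n} {e} → e ∉ U → ind U e ≡ 0
ind-∉ {U = U} {e} e∉U with lookup U e in eq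
... | true  = contradiction (lookup⇒[]= e U eq) e∉U
... | false = refl

ind-⊤ : ∀ {n} (e : Fin n) → ind ⊤ e ≡ 1
ind-⊤ e = cong (if_then 1 else 0) (lookup-replicate e true)

ind-⊥ : ∀ {n} (e : Fin n) → ind ⊥ e ≡ 0
ind-⊥ e = cong (if_then 1 else 0) (lookup-replicate e false)

x-linear : ∀ {n} (v : Fin n → ℕ) (A B C D : Subset n) →
           (∀ e → ind A e + ind B e ≡ ind C e + ind D e) →
           x[ v ] A + x[ v ] B ≡ x[ v ] C + x[ v ] D
x-linear {n} v A B C D ind≡ = begin
  x[ v ] A + x[ v ] B                      ≡⟨ Σℕ-distrib n _ _ ⟨
  Σℕ n (λ e → weighted A e + weighted B e) ≡⟨ Σℕ-cong n pointwise ⟩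
  Σℕ n (λ e → weighted C e + weighted D e) ≡⟨ Σℕ-distrib n _ _ ⟩
  x[ v ] C + x[ v ] D                      ∎
  where
  open ≡-Reasoning
  weighted : Subset n → Fin n → ℕ
  weighted U e = if lookup U e then v e else 0
  weighted≡ : ∀ U e → weighted U e ≡ ind U e * v e
  weighted≡ U e with lookup U e
  ... | true  = sym (+-identityʳ (v e))
  ... | false = refl
  pointwise : ∀ e → weighted A e + weighted B e ≡ weighted C e + weighted D e
  pointwise e = begin
    weighted A e + weighted B e    ≡⟨ cong₂ _+_ (weighted≡ A e) (weighted≡ B e) ⟩
    ind A e * v e + ind B e * v e  ≡⟨ *-distribʳ-+ (v e) (ind A e) (ind B e) ⟨
    (ind A e + ind B e) * v e      ≡⟨ cong (_* v e) (ind≡ e) ⟩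
    (ind C e + ind D e) * v e      ≡⟨ *-distribʳ-+ (v e) (ind C e) (ind D e) ⟩
    ind C e * v e + ind D e * v e  ≡⟨ cong₂ _+_ (weighted≡ C e) (weighted≡ D e) ⟨
    weighted C e + weighted D e    ∎

x-⊥ : ∀ {n} (v : Fin n → ℕ) → x[ v ] ⊥ ≡ 0
x-⊥ {zero}  v = refl
x-⊥ {suc n} v = x-⊥ (λ e → v (suc e))

x-⊤ : ∀ {n} (v : Fin n → ℕ) → x[ v ] ⊤ ≡ Σℕ n v
x-⊤ {n} v = Σℕ-cong n (λ e → cong (if_then v e else 0) (lookup-replicate e true))

x-modular : ∀ {n} (v : Fin n → ℕ) (A B : Subset n) →
            x[ v ] (A ∪ B) + x[ v ] (A ∩ B) ≡ x[ v ] A + x[ v ] B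
x-modular v A B = x-linear v (A ∪ B) (A ∩ B) A B pointwise
  where
  pointwise : ∀ e → ind (A ∪ B) e + ind (A ∩ B) e ≡ ind A e + ind B e
  pointwise e rewrite lookup-zipWith _∨_ e A B | lookup-zipWith _∧_ e A B
    with lookup A e | lookup B e
  ... | true  | true  = refl
  ... | true  | false = refl
  ... | false | true  = refl
  ... | false | false = refl

x-split : ∀ {n} (v : Fin n → ℕ) (A B C : Subset n) →
          (∀ e → ind A e ≡ ind B e + ind C e) → x[ v ] A ≡ x[ v ] B + x[ v ] C
x-split v A B C ind≡ = begin
  x[ v ] A                ≡⟨ +-identityʳ _ ⟨
  x[ v ] A + 0            ≡⟨ cong (x[ v ] A +_) (x-⊥ v) ⟨
  x[ v ] A + x[ v ] ⊥     ≡⟨ x-linear v A ⊥ B C padded ⟩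
  x[ v ] B + x[ v ] C     ∎
  where
  open ≡-Reasoning
  padded : ∀ e → ind A e + ind ⊥ e ≡ ind B e + ind C e
  padded e = trans (cong (ind A e +_) (ind-⊥ e)) (trans (+-identityʳ _) (ind≡ e))

x-split-∪ : ∀ {n} (v : Fin n → ℕ) (R S : Subset n) → x[ v ] (R ∪ S) ≡ x[ v ] S + x[ v ] (R ∩ ∁ S)
x-split-∪ v R S = x-split v (R ∪ S) S (R ∩ ∁ S) pointwise
  where
  pointwise : ∀ e → ind (R ∪ S) e ≡ ind S e + ind (R ∩ ∁ S) e
  pointwise e rewrite lookup-zipWith _∨_ e R S | lookup-zipWith _∧_ e R (∁ S) | lookup-map e not S
    with lookup R e | lookup S e
  ... | true  | true  = refl
  ... | true  | false = refl
  ... | false | true  = refl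
  ... | false | false = refl

x-split-∩ : ∀ {n} (v : Fin n → ℕ) (R S : Subset n) → x[ v ] R ≡ x[ v ] (R ∩ S) + x[ v ] (R ∩ ∁ S)
x-split-∩ v R S = x-split v R (R ∩ S) (R ∩ ∁ S) pointwise
  where
  pointwise : ∀ e → ind R e ≡ ind (R ∩ S) e + ind (R ∩ ∁ S) e
  pointwise e rewrite lookup-zipWith _∧_ e R S | lookup-zipWith _∧_ e R (∁ S) | lookup-map e not S
    with lookup R e | lookup S e
  ... | true  | true  = refl
  ... | true  | false = refl
  ... | false | true  = refl
  ... | false | false = refl

x-cong : ∀ {n} {v w : Fin n → ℕ} (U : Subset n) → (∀ e → v e ≡ w e) → x[ v ] U ≡ x[ w ] U
x-cong {n} U v≗w = Σℕ-cong n (λ e → cong (if lookup U e then_else 0) (v≗w e))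

x-bump : ∀ {n} (v : Fin n → ℕ) (U : Subset n) (i : Fin n) → x[ updateAt v i suc ] U ≡ ind U i + x[ v ] U
x-bump v (true  ∷ U) zero    = refl
x-bump v (false ∷ U) zero    = refl
x-bump v (b     ∷ U) (suc i) =
  trans (cong (head +_) (x-bump (λ e → v (suc e)) U i)) (x∙yz≈y∙xz head (ind U i) (x[ (λ e → v (suc e)) ] U))
  where
  head : ℕ
  head = if b then v zero else 0

move : ∀ {n} → (Fin n → ℕ) → Fin n → Fin n → Fin n → ℕ
move v a b = updateAt (updateAt v a pred) b suc

module _ {n} (v : Fin n → ℕ) {a b : Fin n} (a≢b : a ≢ b) where

  move-source : move v a b a ≡ pred (v a)
  move-source = trans (updateAt-minimal a b _ a≢b) (updateAt-updates a v)

  move-target : move v a b b ≡ suc (v b)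
  move-target = trans (updateAt-updates b _) (cong suc (updateAt-minimal b a v (a≢b ∘ sym)))

  move-elsewhere : ∀ {e} → e ≢ a → e ≢ b → move v a b e ≡ v e
  move-elsewhere e≢a e≢b = trans (updateAt-minimal _ b _ e≢b) (updateAt-minimal _ a v e≢a)

x-move : ∀ {n} (v : Fin n → ℕ) (a b : Fin n) → 1 ≤ v a → ∀ U →
         ind U a + x[ move v a b ] U ≡ ind U b + x[ v ] U
x-move {n} v a b 1≤va U = begin
  ind U a + x[ move v a b ] U         ≡⟨ cong (ind U a +_) (x-bump w U b) ⟩
  ind U a + (ind U b + x[ w ] U)      ≡⟨ x∙yz≈y∙xz (ind U a) (ind U b) _ ⟩
  ind U b + (ind U a + x[ w ] U)      ≡⟨ cong (ind U b +_) (x-bump w U a) ⟨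
  ind U b + x[ updateAt w a suc ] U   ≡⟨ cong (ind U b +_) (x-cong U restore) ⟩
  ind U b + x[ v ] U                  ∎
  where
  open ≡-Reasoning
  w : Fin n → ℕ
  w = updateAt v a pred
  restore : ∀ e → updateAt w a suc e ≡ v e
  restore e with e ≟ᶠ a
  ... | yes refl =
    trans (updateAt-updates a w) (trans (cong suc (updateAt-updates a v)) (suc-pred (v a) ⦃ >-nonZero 1≤va ⦄))
  ... | no e≢a   = trans (updateAt-minimal e a w e≢a) (updateAt-minimal e a v e≢a)

x-move-at : ∀ {n} (v : Fin n → ℕ) {a b : Fin n} → 1 ≤ v a → ∀ U {i j} →
            ind U a ≡ i → ind U b ≡ j → i + x[ move v a b ] U ≡ j + x[ v ] U
x-move-at v {a} {b} 1≤va U refl refl = x-move v a b 1≤va U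

x-move-⊤ : ∀ {n} (v : Fin n → ℕ) (a b : Fin n) → 1 ≤ v a → x[ move v a b ] ⊤ ≡ x[ v ] ⊤
x-move-⊤ v a b 1≤va = suc-injective (x-move-at v 1≤va ⊤ (ind-⊤ a) (ind-⊤ b))

allSubsets : ∀ n → List (Subset n)
allSubsets zero    = [] ∷ []
allSubsets (suc n) = cartesianProductWith _∷_ (true ∷ false ∷ []) (allSubsets n)

allSubsets-complete : ∀ {n} (U : Subset n) → U ∈ˡ allSubsets n
allSubsets-complete []          = here refl
allSubsets-complete (true  ∷ U) =
  ∈-cartesianProductWith⁺ _∷_ {xs = true ∷ false ∷ []} (here refl) (allSubsets-complete U)
allSubsets-complete (false ∷ U) =
  ∈-cartesianProductWith⁺ _∷_ {xs = true ∷ false ∷ []} (there (here refl)) (allSubsets-complete U)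

module _ {n} {P : Subset n → Set} (P? : Decidable P) where

  largest : P ⊥ → (∀ {A B} → P A → P B → P (A ∪ B)) → ∃ λ M → P M × (∀ {U} → P U → U ⊆ M)
  largest P⊥ P∪ = ⋃ members , closed (all-filter P? (allSubsets n))
                , λ {U} PU → ⊆-⋃ (∈-filter⁺ P? (allSubsets-complete U) PU)
    where
    members : List (Subset n)
    members = filter P? (allSubsets n)
    closed : ∀ {Us} → All P Us → P (⋃ Us)
    closed []         = P⊥
    closed (PU ∷ PUs) = P∪ PU (closed PUs)
    ⊆-⋃ : ∀ {U Us} → U ∈ˡ Us → U ⊆ ⋃ Us
    ⊆-⋃ (here refl)                  = p⊆p∪q _
    ⊆-⋃ {Us = V ∷ Us} (there U∈Us) = q⊆p∪q V (⋃ Us) ∘ ⊆-⋃ U∈Us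

  smallest : P ⊤ → (∀ {A B} → P A → P B → P (A ∩ B)) → ∃ λ M → P M × (∀ {U} → P U → M ⊆ U)
  smallest P⊤ P∩ = ⋂ members , closed (all-filter P? (allSubsets n))
                 , λ {U} PU → ⋂-⊆ (∈-filter⁺ P? (allSubsets-complete U) PU)
    where
    members : List (Subset n)
    members = filter P? (allSubsets n)
    closed : ∀ {Us} → All P Us → P (⋂ Us)
    closed []         = P⊤
    closed (PU ∷ PUs) = P∩ PU (closed PUs)
    ⋂-⊆ : ∀ {U Us} → U ∈ˡ Us → ⋂ Us ⊆ U
    ⋂-⊆ {Us = V ∷ Us} (here refl)  = p∩q⊆p V (⋂ Us)
    ⋂-⊆ {Us = V ∷ Us} (there U∈Us) = ⋂-⊆ U∈Us ∘ p∩q⊆q V (⋂ Us)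

exists-larger : ∀ {n} (p q : Fin n → ℕ) (U : Subset n) {g} →
                x[ p ] U ≤ x[ q ] U → g ∈ U → q g < p g → ∃ λ h → h ∈ U × p h < q h
exists-larger {n} p q U {g} pU≤qU g∈U qg<pg with any? (λ h → h ∈? U ×-dec p h <? q h)
... | yes found = found
... | no  none  = contradiction pU≤qU (<⇒≱ (Σℕ-strict n q≤p g qg<pg′))
  where
  q≤p : ∀ e → (if lookup U e then q e else 0) ≤ (if lookup U e then p e else 0)
  q≤p e with lookup U e in e∈U
  ... | true  = ≮⇒≥ (λ pe<qe → none (e , lookup⇒[]= e U e∈U , pe<qe))
  ... | false = z≤n
  qg<pg′ : (if lookup U g then q g else 0) < (if lookup U g then p g else 0)
  qg<pg′ rewrite []=⇒lookup g∈U = qg<pg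

squeeze : ∀ {a b c d} → a ≤ c → b ≤ d → c + d ≤ a + b → a ≡ c × b ≡ d
squeeze {a} {b} {c} {d} a≤c b≤d c+d≤a+b =
  ≤-antisym a≤c (+-cancelʳ-≤ d c a (≤-trans c+d≤a+b (+-monoʳ-≤ a b≤d))) ,
  ≤-antisym b≤d (+-cancelˡ-≤ c d b (≤-trans c+d≤a+b (+-monoˡ-≤ b a≤c)))

module Polymatroid {n} (f : Subset n → ℕ) (isPolymatroid : IsPolymatroid f) where
  open IsPolymatroid isPolymatroid

  InP : (Fin n → ℕ) → Set
  InP p = ∀ U → x[ p ] U ≤ f U

  Tight : (Fin n → ℕ) → Subset n → Set
  Tight p U = x[ p ] U ≡ f U

  -- By submodularity, the tight sets of a point of P(f) form a lattice.
  tight-∪∩ : ∀ {p} → InP p → ∀ {A B} → Tight p A → Tight p B → Tight p (A ∪ B) × Tight p (A ∩ B)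
  tight-∪∩ {p} p∈P {A} {B} tight-A tight-B = squeeze (p∈P (A ∪ B)) (p∈P (A ∩ B)) (begin
    f (A ∪ B) + f (A ∩ B)            ≤⟨ submodular A B ⟩
    f A + f B                        ≡⟨ cong₂ _+_ tight-A tight-B ⟨
    x[ p ] A + x[ p ] B              ≡⟨ x-modular p A B ⟨
    x[ p ] (A ∪ B) + x[ p ] (A ∩ B)  ∎)
    where open ≤-Reasoning

  move-feasible : ∀ {p a b} → InP p → 1 ≤ p a → (∀ {U} → Tight p U → b ∈ U → a ∈ U) → InP (move p a b)
  move-feasible {p} {a} {b} p∈P 1≤pa tight⇒a U with b ∈? U | a ∈? U
  ... | no b∉U | _ = begin
    x[ move p a b ] U               ≤⟨ m≤n+m _ (ind U a) ⟩
    ind U a + x[ move p a b ] U     ≡⟨ x-move-at p 1≤pa U refl (ind-∉ b∉U) ⟩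
    x[ p ] U                        ≤⟨ p∈P U ⟩
    f U                             ∎
    where open ≤-Reasoning
  ... | yes b∈U | yes a∈U =
    ≤-trans (≤-reflexive (suc-injective (x-move-at p 1≤pa U (ind-∈ a∈U) (ind-∈ b∈U)))) (p∈P U)
  ... | yes b∈U | no  a∉U = begin
    x[ move p a b ] U  ≡⟨ x-move-at p 1≤pa U (ind-∉ a∉U) (ind-∈ b∈U) ⟩
    suc (x[ p ] U)     ≤⟨ ≤∧≢⇒< (p∈P U) (λ tight → a∉U (tight⇒a tight b∈U)) ⟩
    f U                ∎
    where open ≤-Reasoning

  cross-inequality : ∀ {p q} → InP p → InP q → x[ p ] ⊤ ≤ x[ q ] ⊤ →
                     ∀ {R S} → Tight p S → Tight q R ⊎ R ≡ ⊤ → x[ p ] (R ∩ ∁ S) ≤ x[ q ] (R ∩ ∁ S)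
  cross-inequality {p} {q} p∈P q∈P p⊤≤q⊤ {R} {S} tight-S R-tight⊎⊤ = +-cancelˡ-≤ (pS + qR∩S) _ _ (begin
    (pS + qR∩S) + x[ p ] W         ≡⟨ xy∙z≈xz∙y pS qR∩S _ ⟩
    (pS + x[ p ] W) + qR∩S         ≡⟨ cong (_+ qR∩S) (x-split-∪ p R S) ⟨
    x[ p ] (R ∪ S) + qR∩S          ≤⟨ key R-tight⊎⊤ ⟩
    x[ q ] R + pS                  ≡⟨ cong (_+ pS) (x-split-∩ q R S) ⟩
    (qR∩S + x[ q ] W) + pS         ≡⟨ xy∙z≈zx∙y qR∩S _ pS ⟩
    (pS + qR∩S) + x[ q ] W         ∎)
    where
    open ≤-Reasoning
    W : Subset n
    W = R ∩ ∁ S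
    pS qR∩S : ℕ
    pS = x[ p ] S
    qR∩S = x[ q ] (R ∩ S)
    -- by submodularity (R tight) or by p(E) ≤ q(E) (R = E)
    key : Tight q R ⊎ R ≡ ⊤ → x[ p ] (R ∪ S) + x[ q ] (R ∩ S) ≤ x[ q ] R + x[ p ] S
    key (inj₁ tight-R) = begin
      x[ p ] (R ∪ S) + x[ q ] (R ∩ S)  ≤⟨ +-mono-≤ (p∈P (R ∪ S)) (q∈P (R ∩ S)) ⟩
      f (R ∪ S) + f (R ∩ S)            ≤⟨ submodular R S ⟩
      f R + f S                        ≡⟨ cong₂ _+_ tight-R tight-S ⟨
      x[ q ] R + x[ p ] S              ∎
    key (inj₂ refl) = begin
      x[ p ] (⊤ ∪ S) + x[ q ] (⊤ ∩ S)
        ≡⟨ cong₂ _+_ (cong x[ p ] (∪-zeroˡ S)) (cong x[ q ] (∩-identityˡ S)) ⟩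
      x[ p ] ⊤ + x[ q ] S              ≤⟨ +-mono-≤ p⊤≤q⊤ (q∈P S) ⟩
      x[ q ] ⊤ + f S                   ≡⟨ cong (x[ q ] ⊤ +_) tight-S ⟨
      x[ q ] ⊤ + x[ p ] S              ∎

  TightAvoiding : (Fin n → ℕ) → Fin n → Subset n → Set
  TightAvoiding p g U = Tight p U × g ∉ U

  TightContaining : (Fin n → ℕ) → Fin n → Subset n → Set
  TightContaining q g U = g ∈ U × (Tight q U ⊎ U ≡ ⊤)

  tightAvoiding? : ∀ p g → Decidable (TightAvoiding p g)
  tightAvoiding? p g U = (x[ p ] U ≟ f U) ×-dec ¬? (g ∈? U)

  tightContaining? : ∀ q g → Decidable (TightContaining q g)
  tightContaining? q g U = g ∈? U ×-dec ((x[ q ] U ≟ f U) ⊎-dec ≡-dec _≟ᵇ_ U ⊤)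

  avoiding-⊥ : ∀ {p g} → TightAvoiding p g ⊥
  avoiding-⊥ {p} = trans (x-⊥ p) (sym normalized) , ∉⊥

  avoiding-∪ : ∀ {p g} → InP p → ∀ {A B} →
               TightAvoiding p g A → TightAvoiding p g B → TightAvoiding p g (A ∪ B)
  avoiding-∪ p∈P {A} {B} (tight-A , g∉A) (tight-B , g∉B) =
    proj₁ (tight-∪∩ p∈P tight-A tight-B) , [ g∉A , g∉B ] ∘ x∈p∪q⁻ A B

  containing-⊤ : ∀ {q g} → TightContaining q g ⊤
  containing-⊤ = ∈⊤ , inj₂ refl

  containing-∩ : ∀ {q g} → InP q → ∀ {A B} →
                 TightContaining q g A → TightContaining q g B → TightContaining q g (A ∩ B)
  containing-∩ {q} q∈P (g∈A , A-cond) (g∈B , B-cond) = x∈p∩q⁺ (g∈A , g∈B) , meet A-cond B-cond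
    where
    meet : ∀ {A B} → Tight q A ⊎ A ≡ ⊤ → Tight q B ⊎ B ≡ ⊤ → Tight q (A ∩ B) ⊎ A ∩ B ≡ ⊤
    meet (inj₁ tight-A) (inj₁ tight-B) = inj₁ (proj₂ (tight-∪∩ q∈P tight-A tight-B))
    meet {A} (inj₁ tight-A) (inj₂ refl) = inj₁ (subst (Tight q) (sym (∩-identityʳ A)) tight-A)
    meet {B = B} (inj₂ refl) B-cond = subst (λ U → Tight q U ⊎ U ≡ ⊤) (sym (∩-identityˡ B)) B-cond

  -- Here h is
  -- taken in R ∖ S for S the largest p-tight set avoiding g and R the smallest set
  -- containing g that is q-tight or E.
  exchange : ∀ {p q g} → InP p → InP q → x[ p ] ⊤ ≤ x[ q ] ⊤ → q g < p g →
             ∃ λ h → p h < q h × InP (move p g h) × InP (move q h g)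
  exchange {p} {q} {g} p∈P q∈P p⊤≤q⊤ qg<pg
    with largest (tightAvoiding? p g) avoiding-⊥ (avoiding-∪ p∈P)
       | smallest (tightContaining? q g) containing-⊤ (containing-∩ q∈P)
  ... | S , (tight-S , g∉S) , S-largest | R , (g∈R , R-tight⊎⊤) , R-smallest
    with exists-larger p q (R ∩ ∁ S) (cross-inequality p∈P q∈P p⊤≤q⊤ tight-S R-tight⊎⊤)
                       (x∈p∩q⁺ (g∈R , x∉p⇒x∈∁p g∉S)) qg<pg
  ... | h , h∈W , ph<qh =
    h , ph<qh , move-feasible p∈P (≤-trans (s≤s z≤n) qg<pg) p-tight⇒g
              , move-feasible q∈P (≤-trans (s≤s z≤n) ph<qh) q-tight⇒h
    where
    -- a p-tight set containing h but not g would lie inside S, yet h ∉ S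
    p-tight⇒g : ∀ {U} → Tight p U → h ∈ U → g ∈ U
    p-tight⇒g {U} tight-U h∈U with g ∈? U
    ... | yes g∈U = g∈U
    ... | no  g∉U = contradiction (p∩q⊆q R (∁ S) h∈W) (x∈p⇒x∉∁p (S-largest (tight-U , g∉U) h∈U))
    -- a q-tight set containing g contains R, hence h
    q-tight⇒h : ∀ {U} → Tight q U → g ∈ U → h ∈ U
    q-tight⇒h tight-U g∈U = R-smallest (g∈U , inj₁ tight-U) (p∩q⊆p R (∁ S) h∈W)

dist₁-sym : ∀ {n} (x y : Fin n → ℕ) → dist₁ x y ≡ dist₁ y x
dist₁-sym {n} x y = Σℕ-cong n (λ e → ∣-∣-comm (x e) (y e))

dist₁-dominated : ∀ {n} (x y : Fin n → ℕ) → (∀ e → x e ≤ y e) → dist₁ x y + x[ x ] ⊤ ≡ x[ y ] ⊤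
dist₁-dominated {n} x y x≤y = begin
  dist₁ x y + x[ x ] ⊤                ≡⟨ cong (dist₁ x y +_) (x-⊤ x) ⟩
  dist₁ x y + Σℕ n x                  ≡⟨ Σℕ-distrib n _ x ⟨
  Σℕ n (λ e → ∣ x e - y e ∣ + x e)    ≡⟨ Σℕ-cong n gap+x≡y ⟩
  Σℕ n y                              ≡⟨ x-⊤ y ⟨
  x[ y ] ⊤                            ∎
  where
  open ≡-Reasoning
  gap+x≡y : ∀ e → ∣ x e - y e ∣ + x e ≡ y e
  gap+x≡y e = trans (cong (_+ x e) (m≤n⇒∣m-n∣≡n∸m (x≤y e))) (m∸n+n≡m (x≤y e))

gap-suc : ∀ {a b} → b < a → ∣ a - suc b ∣ < ∣ a - b ∣
gap-suc {suc a} {zero}  _         = subst (_< suc a) (sym (∣-∣-identityʳ a)) (n<1+n a)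
gap-suc {suc a} {suc b} (s≤s b<a) = gap-suc b<a

gap-pred : ∀ {a b} → a < b → ∣ a - pred b ∣ ≤ ∣ a - b ∣
gap-pred {a} {b} a<b = begin
  ∣ a - pred b ∣  ≡⟨ m≤n⇒∣m-n∣≡n∸m (suc[m]≤n⇒m≤pred[n] a<b) ⟩
  pred b ∸ a      ≤⟨ ∸-monoˡ-≤ a pred[n]≤n ⟩
  b ∸ a           ≡⟨ m≤n⇒∣m-n∣≡n∸m (<⇒≤ a<b) ⟨
  ∣ a - b ∣       ∎
  where open ≤-Reasoning

move-closer : ∀ {n} (x y : Fin n → ℕ) {s r} → y s < x s → x r < y r → dist₁ x (move y r s) < dist₁ x y
move-closer {n} x y {s} {r} ys<xs xr<yr = Σℕ-strict n pointwise s at-s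
  where
  r≢s : r ≢ s
  r≢s refl = <-asym ys<xs xr<yr
  at-s : ∣ x s - move y r s s ∣ < ∣ x s - y s ∣
  at-s rewrite move-target y r≢s = gap-suc ys<xs
  pointwise : ∀ e → ∣ x e - move y r s e ∣ ≤ ∣ x e - y e ∣
  pointwise e with e ≟ᶠ s | e ≟ᶠ r
  ... | yes refl | _        = <⇒≤ at-s
  ... | no _     | yes refl rewrite move-source y r≢s = gap-pred xr<yr
  ... | no e≢s   | no e≢r   = ≤-reflexive (cong (λ z → ∣ x e - z ∣) (move-elsewhere y r≢s e≢r e≢s))

module Adjacent {n} (f : Subset n → ℕ) (isPolymatroid : IsPolymatroid f) where
  open Polymatroid f isPolymatroid

  move-∈B : ∀ {d v a b} → v ∈B[ f , d ] → 1 ≤ v a → InP (move v a b) → move v a b ∈B[ f , d ]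
  move-∈B {v = v} {a} {b} (_ , mass) 1≤va moved∈P = moved∈P , trans (x-move-⊤ v a b 1≤va) mass

  exchange-adjacent : ∀ {d x y} → x ∈B[ f , d ] → y ∈B[ f , suc d ] → 1 < dist₁ x y →
                      ∃₂ λ g h → y g < x g × x h < y h × move x g h ∈B[ f , d ] × move y h g ∈B[ f , suc d ]
  exchange-adjacent {d} {x} {y} x∈B@(x∈P , x-mass) y∈B@(y∈P , y-mass) far with any? (λ g → y g <? x g)
  ... | no x≤y = contradiction (+-cancelʳ-≡ d (dist₁ x y) 1 distance) (>⇒≢ far)
    where
    distance : dist₁ x y + d ≡ 1 + d
    distance = subst₂ (λ i j → dist₁ x y + i ≡ j) x-mass y-mass
                 (dist₁-dominated x y (λ e → ≮⇒≥ (λ ye<xe → x≤y (e , ye<xe))))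
  ... | yes (g , yg<xg) = from-exchange (exchange {x} {y} {g} x∈P y∈P x-mass≤y-mass yg<xg)
    where
    x-mass≤y-mass : x[ x ] ⊤ ≤ x[ y ] ⊤
    x-mass≤y-mass = subst₂ _≤_ (sym x-mass) (sym y-mass) (n≤1+n d)
    from-exchange : (∃ λ h → x h < y h × InP (move x g h) × InP (move y h g)) →
                    ∃₂ λ g h → y g < x g × x h < y h × move x g h ∈B[ f , d ] × move y h g ∈B[ f , suc d ]
    from-exchange (h , xh<yh , x′∈P , y′∈P) =
      g , h , yg<xg , xh<yh
        , move-∈B x∈B (≤-trans (s≤s z≤n) yg<xg) x′∈P , move-∈B y∈B (≤-trans (s≤s z≤n) xh<yh) y′∈P

boundedVectors : ∀ n → ℕ → List (Fin n → ℕ)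
boundedVectors zero    m = Vector.[] ∷ []
boundedVectors (suc n) m = cartesianProductWith Vector._∷_ (upTo (suc m)) (boundedVectors n m)

boundedVectors-complete : ∀ n m (y : Fin n → ℕ) → (∀ e → y e ≤ m) →
                          ∃ λ z → z ∈ˡ boundedVectors n m × (∀ e → y e ≡ z e)
boundedVectors-complete zero    m y y≤m = Vector.[] , here refl , λ ()
boundedVectors-complete (suc n) m y y≤m
  with boundedVectors-complete n m (λ e → y (suc e)) (λ e → y≤m (suc e))
... | z , z∈ , tail≗ = y zero Vector.∷ z
                     , ∈-cartesianProductWith⁺ Vector._∷_ (∈-upTo⁺ (s≤s (y≤m zero))) z∈
                     , λ { zero → refl ; (suc e) → tail≗ e }

module _ {n} (f : Subset n → ℕ) where

  ∈B? : ∀ d → Decidable (_∈B[ f , d ])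
  ∈B? d y with All.all? (λ U → x[ y ] U ≤? f U) (allSubsets n) | x[ y ] ⊤ ≟ d
  ... | yes bounded | yes mass = yes ((λ U → All.lookup bounded (allSubsets-complete U)) , mass)
  ... | no unbounded | _       = no (λ (y∈P , _) → unbounded (All.tabulate (λ {U} _ → y∈P U)))
  ... | yes _ | no wrong-mass   = no (wrong-mass ∘ proj₂)

  ∈B-resp : ∀ {d} {y z : Fin n → ℕ} → (∀ e → y e ≡ z e) → y ∈B[ f , d ] → z ∈B[ f , d ]
  ∈B-resp y≗z (y∈P , mass) =
    (λ U → ≤-trans (≤-reflexive (sym (x-cong U y≗z))) (y∈P U)) , trans (sym (x-cong ⊤ y≗z)) mass

  ∈B-bounded : ∀ {d y} → y ∈B[ f , d ] → ∀ e → y e ≤ d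
  ∈B-bounded {y = y} (_ , mass) e = ≤-trans (entry≤Σ n y e) (≤-reflexive (trans (sym (x-⊤ y)) mass))

module OrderedGroup {c ℓ₁ ℓ₂} (G : OrderedAbelianGroup c ℓ₁ ℓ₂) where
  open OrderedAbelianGroup G
    renaming (_≤_ to _≼_; +-monoˡ-≤ to ∙-monoˡ-≼; refl to ≈-refl; sym to ≈-sym; trans to ≈-trans)
  open IsTotalOrder isTotalOrder using (isPartialOrder)
  open IsTotalOrder isTotalOrder public using () renaming (refl to ≼-refl; trans to ≼-trans)

  poset : Poset c ℓ₁ ℓ₂
  poset = record { isPartialOrder = isPartialOrder }
  open import Relation.Binary.Reasoning.PartialOrder poset
  open import Algebra.Solver.CommutativeMonoid commutativeMonoid using (solve; _⊕_; _⊜_)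

  ∙-monoʳ-≼ : ∀ {x y} z → x ≼ y → (z ∙ x) ≼ (z ∙ y)
  ∙-monoʳ-≼ {x} {y} z x≤y = begin
    z ∙ x  ≈⟨ comm z x ⟩
    x ∙ z  ≤⟨ ∙-monoˡ-≼ z x≤y ⟩
    y ∙ z  ≈⟨ comm y z ⟩
    z ∙ y  ∎

  cancel-inverse : ∀ x y → x ∙ (y ∙ y ⁻¹) ≈ x
  cancel-inverse x y = ≈-trans (∙-congˡ (inverseʳ y)) (identityʳ x)

  ∙-cancelʳ-≼ : ∀ {x y} z → (x ∙ z) ≼ (y ∙ z) → x ≼ y
  ∙-cancelʳ-≼ {x} {y} z xz≤yz = begin
    x                    ≈⟨ cancel-inverse x z ⟨
    x ∙ (z ∙ z ⁻¹)       ≈⟨ assoc x z (z ⁻¹) ⟨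
    (x ∙ z) ∙ z ⁻¹       ≤⟨ ∙-monoˡ-≼ (z ⁻¹) xz≤yz ⟩
    (y ∙ z) ∙ z ⁻¹       ≈⟨ assoc y z (z ⁻¹) ⟩
    y ∙ (z ∙ z ⁻¹)       ≈⟨ cancel-inverse y z ⟩
    y                    ∎

  balance-⇒ : ∀ {a b p q} → a ∙ p ≈ b ∙ q → a ≼ b → q ≼ p
  balance-⇒ {a} {b} {p} {q} ap≈bq a≤b = ∙-cancelʳ-≼ b (begin
    q ∙ b  ≈⟨ comm q b ⟩
    b ∙ q  ≈⟨ ap≈bq ⟨
    a ∙ p  ≤⟨ ∙-monoˡ-≼ p a≤b ⟩
    b ∙ p  ≈⟨ comm b p ⟩
    p ∙ b  ∎)

  balance-⇐ : ∀ {a b p q} → a ∙ p ≈ b ∙ q → q ≼ p → a ≼ b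
  balance-⇐ {a} {b} {p} {q} ap≈bq q≤p = ∙-cancelʳ-≼ p (begin
    a ∙ p  ≈⟨ ap≈bq ⟩
    b ∙ q  ≤⟨ ∙-monoʳ-≼ b q≤p ⟩
    b ∙ p  ∎)

  pairs⇒differences : ∀ {X Y u v w z} → X ∙ (u ∙ w) ≈ Y ∙ (v ∙ z) → X ∙ (u - v) ≈ Y ∙ (z - w)
  pairs⇒differences {X} {Y} {u} {v} {w} {z} trade = begin-equality
    X ∙ (u - v)                      ≈⟨ cancel-inverse _ w ⟨
    (X ∙ (u - v)) ∙ (w ∙ w ⁻¹)
      ≈⟨ solve 5 (λ X u v′ w w′ → (X ⊕ (u ⊕ v′)) ⊕ (w ⊕ w′) ⊜ (X ⊕ (u ⊕ w)) ⊕ (v′ ⊕ w′)) ≈-refl X u (v ⁻¹) w (w ⁻¹) ⟩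
    (X ∙ (u ∙ w)) ∙ (v ⁻¹ ∙ w ⁻¹)    ≈⟨ ∙-congʳ trade ⟩
    (Y ∙ (v ∙ z)) ∙ (v ⁻¹ ∙ w ⁻¹)
      ≈⟨ solve 5 (λ Y v v′ z w′ → (Y ⊕ (v ⊕ z)) ⊕ (v′ ⊕ w′) ⊜ (Y ⊕ (z ⊕ w′)) ⊕ (v ⊕ v′)) ≈-refl Y v (v ⁻¹) z (w ⁻¹) ⟩
    (Y ∙ (z - w)) ∙ (v ∙ v ⁻¹)       ≈⟨ cancel-inverse _ v ⟩
    Y ∙ (z - w)                      ∎

  -- Regularity makes every C(·; s) convex: its marginal costs increase.
  marginal-mono : ∀ {C} → IsRegular G C → ∀ s {k k′} → k ≤ k′ → C⁻ G C k s ≼ C⁻ G C k′ s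
  marginal-mono {C} regular s k≤k′ = go (≤⇒≤′ k≤k′)
    where
    open IsRegular regular
    go : ∀ {k k′} → k ≤′ k′ → C⁻ G C k s ≼ C⁻ G C k′ s
    go (≤′-reflexive refl) = ≼-refl
    go (≤′-step k≤′k′)     = ≼-trans (go k≤′k′) (≼-trans (reg₁ _ s) (reg₂ _ s))

module Optimization {c ℓ₁ ℓ₂} (G : OrderedAbelianGroup c ℓ₁ ℓ₂) {n : ℕ}
                    (f : Subset n → ℕ) (isPolymatroid : IsPolymatroid f) (t : Fin n → ℕ)
                    (C : Fin n → ℕ → ℕ → OrderedAbelianGroup.Carrier G)
                    (regular : ∀ e → IsRegular G (C e)) where
  open OrderedAbelianGroup G
    using (Carrier; _≈_; _∙_; _-_; isTotalOrder; commutativeMonoid) renaming (_≤_ to _≼_)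
  open OrderedGroup G using (poset; ≼-trans; balance-⇒; balance-⇐; pairs⇒differences; marginal-mono)
  open OrderedAbelianGroup G using () renaming (sym to ≈-sym; reflexive to ≈-reflexive)
  open FinSum commutativeMonoid using (∑-exchange₂)
  open Polymatroid f isPolymatroid
  open import Relation.Binary.Reasoning.PartialOrder poset
    using (begin_; step-≤; step-≈-⟩; _∎)

  cost : (Fin n → ℕ) → Carrier
  cost = totalCost G C t

  Optimal : ℕ → (Fin n → ℕ) → Set ℓ₂
  Optimal = IsOptimal G f C t

  cost-move : ∀ v {a b k} → a ≢ b → v a ≡ suc k →
              (cost (move v a b) ∙ C⁻ G (C a) k (t a)) ≈ (cost v ∙ C⁻ G (C b) (v b) (t b))
  cost-move v {a} {b} {k} a≢b va≡1+k =
    subst₂ (λ saved paid → (cost (move v a b) ∙ saved) ≈ (cost v ∙ paid))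
      (cong₂ (λ i j → C a i (t a) - C a j (t a)) va≡1+k (trans (move-source v a≢b) (cong pred va≡1+k)))
      (cong (λ i → C b i (t b) - C b (v b) (t b)) (move-target v a≢b))
      (pairs⇒differences (∑-exchange₂ n a b a≢b unchanged))
    where
    unchanged : ∀ e → e ≢ a → e ≢ b → C e (move v a b e) (t e) ≈ C e (v e) (t e)
    unchanged e e≢a e≢b = ≈-reflexive (cong (λ i → C e i (t e)) (move-elsewhere v a≢b e≢a e≢b))

  -- If x may move a unit from s to r and y from r to s, then by optimality
  -- of x and convexity the move of y does not increase its cost, so it stays optimal.
  improve : ∀ {d d′ x y s r} → Optimal d x → Optimal d′ y → y s < x s → x r < y r →
            move x s r ∈B[ f , d ] → move y r s ∈B[ f , d′ ] → Optimal d′ (move y r s)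
  improve {x = x} {y} {s} {r} (_ , x-optimal) (_ , y-optimal) ys<xs xr<yr x′∈B y′∈B =
    y′∈B , λ w w∈B → ≼-trans cheaper (y-optimal w w∈B)
    where
    s≢r : s ≢ r
    s≢r refl = <-asym ys<xs xr<yr
    xs≡ : x s ≡ suc (pred (x s))
    xs≡ = sym (suc-pred (x s) ⦃ >-nonZero (≤-trans (s≤s z≤n) ys<xs) ⦄)
    yr≡ : y r ≡ suc (pred (y r))
    yr≡ = sym (suc-pred (y r) ⦃ >-nonZero (≤-trans (s≤s z≤n) xr<yr) ⦄)
    x-marginals : C⁻ G (C s) (pred (x s)) (t s) ≼ C⁻ G (C r) (x r) (t r)
    x-marginals = balance-⇒ (≈-sym (cost-move x s≢r xs≡)) (x-optimal _ x′∈B)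
    y-marginals : C⁻ G (C s) (y s) (t s) ≼ C⁻ G (C r) (pred (y r)) (t r)
    y-marginals = begin
      C⁻ G (C s) (y s) (t s)           ≤⟨ marginal-mono (regular s) (t s) (suc[m]≤n⇒m≤pred[n] ys<xs) ⟩
      C⁻ G (C s) (pred (x s)) (t s)    ≤⟨ x-marginals ⟩
      C⁻ G (C r) (x r) (t r)           ≤⟨ marginal-mono (regular r) (t r) (suc[m]≤n⇒m≤pred[n] xr<yr) ⟩
      C⁻ G (C r) (pred (y r)) (t r)    ∎
    cheaper : cost (move y r s) ≼ cost y
    cheaper = balance-⇐ (cost-move y (s≢r ∘ sym) yr≡) y-marginals

  cost-cong : ∀ {v w : Fin n → ℕ} → (∀ e → v e ≡ w e) → cost v ≈ cost w
  cost-cong v≗w = FinSum.∑-cong commutativeMonoid n (λ e → ≈-reflexive (cong (λ i → C e i (t e)) (v≗w e)))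

  -- B_f(d) is finite, so when it is nonempty it contains a cheapest point.
  optimum-exists : ∀ {d} → (∃ λ y → y ∈B[ f , d ]) → ∃ (Optimal d)
  optimum-exists {d} (y₀ , y₀∈B) = cheapest , argmin-all cost y₀∈B (all-filter (∈B? f d) vectors) , cheapest-optimal
    where
    totalOrder : TotalOrder c ℓ₁ ℓ₂
    totalOrder = record { isTotalOrder = isTotalOrder }
    open import Data.List.Extrema totalOrder using (argmin; argmin-all; f[argmin]≤f[xs])
    vectors candidates : List (Fin n → ℕ)
    vectors = boundedVectors n d
    candidates = filter (∈B? f d) vectors
    cheapest : Fin n → ℕ
    cheapest = argmin cost y₀ candidates
    below-candidates : ∀ {w} → w ∈ˡ candidates → cost cheapest ≼ cost w
    below-candidates = All.lookup (f[argmin]≤f[xs] {f = cost} y₀ candidates)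
    cheapest-optimal : ∀ y → y ∈B[ f , d ] → cost cheapest ≼ cost y
    cheapest-optimal y y∈B with boundedVectors-complete n d y (∈B-bounded f y∈B)
    ... | w , w∈vectors , y≗w = begin
      cost cheapest  ≤⟨ below-candidates (∈-filter⁺ (∈B? f d) w∈vectors (∈B-resp f y≗w y∈B)) ⟩
      cost w         ≈⟨ cost-cong (sym ∘ y≗w) ⟩
      cost y         ∎

  open Adjacent f isPolymatroid using (exchange-adjacent)

  descent : ∀ {d d′ x y} → Optimal d x → Optimal d′ y → d′ ≡ suc d ⊎ d ≡ suc d′ → 1 < dist₁ x y →
            ∃ λ y′ → Optimal d′ y′ × dist₁ x y′ < dist₁ x y
  descent {d} {x = x} {y} x-opt y-opt (inj₁ refl) far =
    step (exchange-adjacent (proj₁ x-opt) (proj₁ y-opt) far)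
    where
    step : (∃₂ λ s r → y s < x s × x r < y r × move x s r ∈B[ f , d ] × move y r s ∈B[ f , suc d ]) →
           ∃ λ y′ → Optimal (suc d) y′ × dist₁ x y′ < dist₁ x y
    step (s , r , ys<xs , xr<yr , x′∈B , y′∈B) =
      move y r s , improve x-opt y-opt ys<xs xr<yr x′∈B y′∈B , move-closer x y ys<xs xr<yr
  descent {d′ = d′} {x} {y} x-opt y-opt (inj₂ refl) far =
    step (exchange-adjacent (proj₁ y-opt) (proj₁ x-opt) (subst (1 <_) (dist₁-sym x y) far))
    where
    step : (∃₂ λ r s → x r < y r × y s < x s × move y r s ∈B[ f , d′ ] × move x s r ∈B[ f , suc d′ ]) →
           ∃ λ y′ → Optimal d′ y′ × dist₁ x y′ < dist₁ x y
    step (r , s , xr<yr , ys<xs , y′∈B , x′∈B) =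
      move y r s , improve x-opt y-opt ys<xs xr<yr x′∈B y′∈B , move-closer x y ys<xs xr<yr

  nearest : ∀ {d d′ x} → Optimal d x → d′ ≡ suc d ⊎ d ≡ suc d′ →
            ∀ y → Optimal d′ y → Acc _<_ (dist₁ x y) → ∃ λ x′ → Optimal d′ x′ × dist₁ x x′ ≤ 1
  nearest {d′ = d′} {x} x-opt adjacent y y-opt (acc closer-accessible) with dist₁ x y ≤? 1
  ... | yes close = y , y-opt , close
  ... | no  far   = continue (descent x-opt y-opt adjacent (≰⇒> far))
    where
    continue : (∃ λ y′ → Optimal d′ y′ × dist₁ x y′ < dist₁ x y) →
               ∃ λ x′ → Optimal d′ x′ × dist₁ x x′ ≤ 1
    continue (y′ , y′-opt , closer) = nearest x-opt adjacent y′ y′-opt (closer-accessible closer)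

-- Theorem 3.4.  Take any optimal solution y of P(t,d′), which exists because B_f(d′) is finite
-- and nonempty, and descend from it towards x until the distance is at most 1.
theorem3p4 : ∀ {c ℓ₁ ℓ₂} (G : OrderedAbelianGroup c ℓ₁ ℓ₂) →
    (n : ℕ) → 1 ≤ n →
    (f : Subset n → ℕ) → IsPolymatroid f →
    (t : Fin n → ℕ) →
    (C : Fin n → ℕ → ℕ → OrderedAbelianGroup.Carrier G) →
    (∀ e x s → OrderedAbelianGroup._≤_ G (OrderedAbelianGroup.ε G) (C e x s)) →
    (∀ e → IsRegular G (C e)) →
    (D : ℕ → Set) → (∀ d → D d → ∃ λ x → x ∈B[ f , d ]) →
    ∀ d d′ → D d → D d′ → (d′ ≡ suc d ⊎ d ≡ suc d′) →
    ∀ x → IsOptimal G f C t d x →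
    ∃ λ x′ → IsOptimal G f C t d′ x′ × dist₁ x x′ ≤ 1
theorem3p4 G n _ f isPolymatroid t C _ regular D B-nonempty d d′ _ d′∈D adjacent x x-optimal =
  descend-from (optimum-exists (B-nonempty d′ d′∈D))
  where
  open Optimization G f isPolymatroid t C regular
  descend-from : ∃ (Optimal d′) → ∃ λ x′ → Optimal d′ x′ × dist₁ x x′ ≤ 1
  descend-from (y , y-optimal) = nearest x-optimal adjacent y y-optimal (<-wellFounded (dist₁ x y))
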